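{- No graph in the family $\mathcal{S}$ is a substar graph. Here $\mathcal{S}$ consists of the following graphs. (1) The graph $H_1$ with vertex set $\{w,x,a,y,b,z\}$ and edge set $\{ax, xw, wy, yb\}\cup\{za,zx,zw,zy,zb\}$ (a path $a x w y b$ together with a vertex $z$ adjacent to all five path vertices). (2) The graphs of type $H_2$: each has vertex set $\{u,x,a,v,y,b,z\}$, contains the edges $ux, xa, vy, yb$ and $zu,zx,za,zv,zy,zb$, and in addition, among the pairs $uv, uy, ub, vx, va$, exactly one of the following sets of edges: (i) none of them; (ii) exactly $uv, vx, va$ (so $N(u)\cap\{v,y,b\}=\{v\}$ and $N(v)\cap\{u,x,a\}=\{u,x,a\}$); (iii) all of $uv,uy,ub,vx,va$. There are no other edges. (3) For every integer $k\ge 3$, the graph $H_3^k$ with vertex set $\{u,v,c_1,\ldots,c_{k-1},a_1,\ldots,a_k\}$ and edge set $$\left(\binom{\{u,v,c_1,\ldots,c_{k-1}\}}{2}\cup\{ua_1, va_k\}\cup\bigcup_{i=1}^{k-1}\{a_ic_i, c_ia_{i+1}\}\right)\setminus\{uv\}.$$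
   Context: A star is a tree containing a vertex adjacent to all other vertices of the tree (a single vertex counts as a star). A graph $G$ is a substar graph if there exist a tree $T$ and an assignment to each vertex $v$ of $G$ of a subtree $f(v)$ of $T$ that is a star, such that two distinct vertices $x,y$ of $G$ are adjacent if and only if $f(x)$ and $f(y)$ share a vertex of $T$. For $\{\cdot\}$ a set, $\binom{\cdot}{2}$ denotes the set of all 2-element subsets; $N(v)$ is the neighborhood of $v$. -}

module Defs where

open import Data.Nat using (ℕ; zero; suc; _+_; _≤_; _<_)
open import Data.Fin using (Fin; zero; suc; inject₁; fromℕ)
open import Data.Fin.Subset using (Subset; _∈_)
open import Data.Bool using (Bool; true; false; T; _∨_)
open import Data.Product using (Σ; ∃; _×_; _,_)
open import Data.Sum using (_⊎_)
open import Data.Unit using (⊤)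
open import Data.Empty using (⊥)
open import Relation.Nullary using (¬_)
open import Relation.Binary.PropositionalEquality using (_≡_; _≢_)
open import Function.Definitions using (Injective)

data Walk {m : ℕ} (E : Fin m → Fin m → Bool) : Fin m → Fin m → Set where
  here : ∀ {x} → Walk E x x
  step : ∀ {x y z} → T (E x y) → Walk E y z → Walk E x z

IsCycle : {m : ℕ} (E : Fin m → Fin m → Bool) (k : ℕ) → (Fin (suc (suc (suc k))) → Fin m) → Set
IsCycle E k c =
  Injective _≡_ _≡_ c
  × (∀ (i : Fin (suc (suc k))) → T (E (c (inject₁ i)) (c (suc i))))
  × T (E (c (fromℕ (suc (suc k)))) (c zero))

record IsTree {m : ℕ} (E : Fin m → Fin m → Bool) : Set where
  field
    nonempty  : 0 < m
    symmetric : ∀ x y → E x y ≡ E y x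
    irreflexive : ∀ x → E x x ≡ false
    connected : ∀ x y → Walk E x y
    acyclic   : ∀ k (c : Fin (suc (suc (suc k))) → Fin m) → ¬ IsCycle E k c

-- A vertex set S of the tree spans a star subtree: it has a centre in S
-- adjacent to every other vertex of S (a single vertex is a star).
IsStar : {m : ℕ} (E : Fin m → Fin m → Bool) → Subset m → Set
IsStar {m} E S = Σ (Fin m) λ c → c ∈ S × (∀ t → t ∈ S → t ≢ c → T (E c t))

IsSubstar : (V : Set) → (V → V → Set) → Set
IsSubstar V Adj =
  Σ ℕ λ m → Σ (Fin m → Fin m → Bool) λ E → IsTree E ×
  Σ (V → Subset m) λ f → (∀ v → IsStar E (f v)) ×
  (∀ x y → x ≢ y →
     (Adj x y → Σ (Fin m) λ t → t ∈ f x × t ∈ f y) ×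
     ((Σ (Fin m) λ t → t ∈ f x × t ∈ f y) → Adj x y))

data V₁ : Set where
  w x a y b z : V₁

edge₁ : V₁ → V₁ → Bool
edge₁ a x = true
edge₁ x w = true
edge₁ w y = true
edge₁ y b = true
edge₁ z a = true
edge₁ z x = true
edge₁ z w = true
edge₁ z y = true
edge₁ z b = true
edge₁ _ _ = false

Adj₁ : V₁ → V₁ → Set
Adj₁ p q = T (edge₁ p q ∨ edge₁ q p)

data V₂ : Set where
  u x a v y b z : V₂

data H₂Type : Set where
  type-i type-ii type-iii : H₂Type

edge₂ : H₂Type → V₂ → V₂ → Bool
edge₂ _ u x = true
edge₂ _ x a = true
edge₂ _ v y = true
edge₂ _ y b = true
edge₂ _ z u = true
edge₂ _ z x = true
edge₂ _ z a = true
edge₂ _ z v = true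
edge₂ _ z y = true
edge₂ _ z b = true
edge₂ type-ii  u v = true
edge₂ type-ii  v x = true
edge₂ type-ii  v a = true
edge₂ type-iii u v = true
edge₂ type-iii u y = true
edge₂ type-iii u b = true
edge₂ type-iii v x = true
edge₂ type-iii v a = true
edge₂ _ _ _ = false

Adj₂ : H₂Type → V₂ → V₂ → Set
Adj₂ t p q = T (edge₂ t p q ∨ edge₂ t q p)

data V₃ (k : ℕ) : Set where
  u v : V₃ k
  c : (i : ℕ) → 1 ≤ i → i < k → V₃ k
  a : (i : ℕ) → 1 ≤ i → i ≤ k → V₃ k

Adj₃ : (k : ℕ) → V₃ k → V₃ k → Set
Adj₃ k u u = ⊥
Adj₃ k u v = ⊥
Adj₃ k u (c _ _ _) = ⊤
Adj₃ k u (a i _ _) = i ≡ 1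
Adj₃ k v u = ⊥
Adj₃ k v v = ⊥
Adj₃ k v (c _ _ _) = ⊤
Adj₃ k v (a i _ _) = i ≡ k
Adj₃ k (c _ _ _) u = ⊤
Adj₃ k (c _ _ _) v = ⊤
Adj₃ k (c i _ _) (c j _ _) = i ≢ j
Adj₃ k (c i _ _) (a j _ _) = j ≡ i ⊎ j ≡ suc i
Adj₃ k (a i _ _) u = i ≡ 1
Adj₃ k (a i _ _) v = i ≡ k
Adj₃ k (a i _ _) (c j _ _) = i ≡ j ⊎ i ≡ suc j
Adj₃ k (a _ _ _) (a _ _ _) = ⊥

-- Everything rests on one fact about a tree T and a vertex γ of T: two
-- neighbours of γ that are joined by a walk avoiding γ are equal (a shortest
-- such walk together with γ would be a cycle).  Call a neighbour of γ lying in
-- a star S that avoids γ a port of S; since a star avoiding γ is connected in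
-- T − γ, stars avoiding γ that are chained together by pairwise meetings all
-- have the same port.  From this we derive three local rules about stars:
--   * a star through γ that meets a star Q avoiding γ contains the port of Q;
--   * a star containing two distinct neighbours of γ is centred at γ;
--   * (middle rule) if f(z) is centred at γ and P, Q, R are stars meeting f(z)
--     with P ∩ Q, Q ∩ R nonempty and P ∩ R empty, then γ ∈ Q.
-- For H₁ and H₂ the middle rule puts the centre of f(z) into both f(x) and
-- f(y) although x ≁ y.  For H₃ᵏ we take γ the centre of f(c₁) and distinguish
-- whether γ ∈ f(u), γ ∈ f(c₂), γ ∈ f(v); in each case two ports are forced to
-- coincide, or (when γ ∈ f(u)) every f(cᵢ) is centred at γ by induction on i,
-- and the port of f(aₖ) then lands in f(c₁), contradicting aₖ ≁ c₁.
module Submission where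

open import Data.Nat using (ℕ; zero; suc; _+_; _≤_; _<_; s≤s; z≤n)
open import Data.Nat.Properties using (≤-refl; ≤-trans; n≤1+n; <⇒≤; <⇒≢)
open import Data.Fin using (Fin; zero; suc; inject₁; fromℕ; _≟_)
open import Data.Fin.Subset using (Subset; _∈_; _∉_)
open import Data.Fin.Subset.Properties using (_∈?_)
open import Data.Bool using (Bool; T)
open import Function using (_∘_)
open import Data.Product using (Σ; _×_; _,_; proj₁; proj₂)
open import Data.Sum using (inj₁; inj₂)
open import Data.Unit using (⊤; tt)
open import Data.Empty using (⊥; ⊥-elim)
open import Data.List using (List; []; _∷_)
open import Data.List.Relation.Unary.All as All using (All; []; _∷_)
import Data.List.Relation.Unary.Any as Any
import Data.List.Membership.DecPropositional as DecMembership
open import Relation.Nullary using (¬_; Dec; yes; no)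
open import Relation.Binary.PropositionalEquality using (_≡_; _≢_; refl; sym; cong; subst; ≢-sym)

open import Defs using (Walk; here; step; IsTree; IsStar; IsCycle; IsSubstar;
  V₁; module V₁; Adj₁; V₂; module V₂; H₂Type; type-i; type-ii; type-iii; Adj₂;
  V₃; module V₃; Adj₃)

module TreeFacts {m : ℕ} {E : Fin m → Fin m → Bool} (tree : IsTree E) where
  open IsTree tree
  open DecMembership (_≟_ {m}) using () renaming (_∈_ to _∈ᴸ_; _∉_ to _∉ᴸ_; _∈?_ to _∈ᴸ?_)

  private variable
    γ s t x y z : Fin m
    P Q R S Z : Subset m

  symE : T (E x y) → T (E y x)
  symE {x} {y} = subst T (symmetric x y)

  neighbour≢ : T (E γ s) → s ≢ γ
  neighbour≢ {γ} e refl = subst T (irreflexive γ) e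

  length : Walk E x y → ℕ
  length here       = 0
  length (step _ w) = suc (length w)

  vertices : Walk E x y → List (Fin m)
  vertices {x} here       = x ∷ []
  vertices {x} (step _ w) = x ∷ vertices w

  IsPath : Walk E x y → Set
  IsPath here           = ⊤
  IsPath {x} (step _ w) = x ∉ᴸ vertices w × IsPath w

  PathWithin : (Fin m → Set) → Fin m → Fin m → Set
  PathWithin A x y = Σ (Walk E x y) λ w → All A (vertices w) × IsPath w

  -- The i-th vertex of a walk; needed to present a cycle as an indexed family.
  vertexAt : (w : Walk E x y) → Fin (suc (length w)) → Fin m
  vertexAt {x} here _           = x
  vertexAt {x} (step _ w) zero  = x
  vertexAt (step _ w) (suc i)   = vertexAt w i

  vertexAt-∈ : (w : Walk E x y) (i : Fin (suc (length w))) → vertexAt w i ∈ᴸ vertices w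
  vertexAt-∈ here zero          = Any.here refl
  vertexAt-∈ (step _ w) zero    = Any.here refl
  vertexAt-∈ (step _ w) (suc i) = Any.there (vertexAt-∈ w i)

  vertexAt-first : (w : Walk E x y) → vertexAt w zero ≡ x
  vertexAt-first here       = refl
  vertexAt-first (step _ w) = refl

  vertexAt-last : (w : Walk E x y) → vertexAt w (fromℕ (length w)) ≡ y
  vertexAt-last here       = refl
  vertexAt-last (step _ w) = vertexAt-last w

  vertexAt-adjacent : (w : Walk E x y) (i : Fin (length w)) →
                      T (E (vertexAt w (inject₁ i)) (vertexAt w (suc i)))
  vertexAt-adjacent (step e w) zero    = subst (λ q → T (E _ q)) (sym (vertexAt-first w)) e
  vertexAt-adjacent (step e w) (suc i) = vertexAt-adjacent w i

  vertexAt-injective : (w : Walk E x y) → IsPath w → ∀ {i j} → vertexAt w i ≡ vertexAt w j → i ≡ j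
  vertexAt-injective here _ {zero} {zero} _ = refl
  vertexAt-injective (step _ w) _ {zero} {zero} _ = refl
  vertexAt-injective (step _ w) (x∉w , _) {zero} {suc j} eq =
    ⊥-elim (x∉w (subst (_∈ᴸ vertices w) (sym eq) (vertexAt-∈ w j)))
  vertexAt-injective (step _ w) (x∉w , _) {suc i} {zero} eq =
    ⊥-elim (x∉w (subst (_∈ᴸ vertices w) eq (vertexAt-∈ w i)))
  vertexAt-injective (step _ w) (_ , path) {suc i} {suc j} eq =
    cong suc (vertexAt-injective w path eq)

  suffixFrom : {A : Fin m → Set} (w : Walk E x y) → t ∈ᴸ vertices w →
               All A (vertices w) → IsPath w → PathWithin A t y
  suffixFrom here (Any.here refl) inP _ = here , inP , tt
  suffixFrom (step e w) (Any.here refl) inP path = step e w , inP , path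
  suffixFrom (step e w) (Any.there t∈w) (_ ∷ inP) (_ , path) = suffixFrom w t∈w inP path

  toPath : {A : Fin m → Set} (w : Walk E x y) → All A (vertices w) → PathWithin A x y
  toPath here inP = here , inP , tt
  toPath {x} (step e w) (px ∷ inP) with toPath w inP
  ... | w′ , inP′ , path′ with x ∈ᴸ? vertices w′
  ...   | yes x∈w′ = suffixFrom w′ x∈w′ inP′ path′
  ...   | no x∉w′  = step e w′ , px ∷ inP′ , x∉w′ , path′

  AvoidingWalk : Fin m → Fin m → Fin m → Set
  AvoidingWalk γ x y = Σ (Walk E x y) λ w → All (_≢ γ) (vertices w)

  _++ʷ_ : Walk E x y → Walk E y z → Walk E x z
  here     ++ʷ w₂ = w₂
  step e w ++ʷ w₂ = step e (w ++ʷ w₂)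

  all-++ʷ : {A : Fin m → Set} (w₁ : Walk E x y) (w₂ : Walk E y z) →
            All A (vertices w₁) → All A (vertices w₂) → All A (vertices (w₁ ++ʷ w₂))
  all-++ʷ here w₂ (_ ∷ []) all₂ = all₂
  all-++ʷ (step e w₁) w₂ (p ∷ all₁) all₂ = p ∷ all-++ʷ w₁ w₂ all₁ all₂

  _⨾_ : AvoidingWalk γ x y → AvoidingWalk γ y z → AvoidingWalk γ x z
  (w₁ , all₁) ⨾ (w₂ , all₂) = w₁ ++ʷ w₂ , all-++ʷ w₁ w₂ all₁ all₂

  -- The basic fact: neighbours of γ joined by a path avoiding γ are equal,
  -- since otherwise γ followed by the path is a cycle.
  pathNeighboursEqual : (w : Walk E x y) → All (_≢ γ) (vertices w) → IsPath w →
                        T (E γ x) → T (E γ y) → x ≡ y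
  pathNeighboursEqual here _ _ _ _ = refl
  pathNeighboursEqual {γ = γ} (step e w₁) avoids path γx γy =
    ⊥-elim (acyclic (length w₁) cycle (injective , consecutive , closing))
    where
      w = step e w₁
      cycle : Fin (suc (suc (suc (length w₁)))) → Fin m
      cycle zero    = γ
      cycle (suc i) = vertexAt w i
      avoidsγ : ∀ i → vertexAt w i ≢ γ
      avoidsγ i = All.lookup avoids (vertexAt-∈ w i)
      injective : ∀ {i j} → cycle i ≡ cycle j → i ≡ j
      injective {zero} {zero} _      = refl
      injective {zero} {suc j} eq    = ⊥-elim (avoidsγ j (sym eq))
      injective {suc i} {zero} eq    = ⊥-elim (avoidsγ i eq)
      injective {suc i} {suc j} eq   = cong suc (vertexAt-injective w path eq)
      consecutive : ∀ i → T (E (cycle (inject₁ i)) (cycle (suc i)))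
      consecutive zero    = γx
      consecutive (suc i) = vertexAt-adjacent w i
      closing : T (E (cycle (fromℕ (suc (suc (length w₁))))) γ)
      closing = subst (λ q → T (E q γ)) (sym (vertexAt-last w)) (symE γy)

  neighboursEqual : AvoidingWalk γ x y → T (E γ x) → T (E γ y) → x ≡ y
  neighboursEqual (w , avoids) γx γy with toPath w avoids
  ... | w′ , avoids′ , path′ = pathNeighboursEqual w′ avoids′ path′ γx γy

  CentredAt : Fin m → Subset m → Set
  CentredAt γ S = ∀ s → s ∈ S → s ≢ γ → T (E γ s)

  Meet : Subset m → Subset m → Set
  Meet S R = Σ (Fin m) λ t → t ∈ S × t ∈ R

  centre : IsStar E S → Fin m
  centre = proj₁

  centre-∈ : (st : IsStar E S) → centre st ∈ S
  centre-∈ st = proj₁ (proj₂ st)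

  centred : (st : IsStar E S) → CentredAt (centre st) S
  centred st = proj₂ (proj₂ st)

  ∉⇒≢ : γ ∉ S → s ∈ S → s ≢ γ
  ∉⇒≢ γ∉S s∈S refl = γ∉S s∈S

  throughCentre : (st : IsStar E S) → centre st ≢ γ → s ∈ S → t ∈ S → s ≢ γ → t ≢ γ →
                  AvoidingWalk γ s t
  throughCentre {γ = γ} {s} {t} st d≢γ s∈S t∈S s≢γ t≢γ = toCentre ⨾ fromCentre
    where
      d = centre st
      edge : ∀ {p q} → T (E p q) → p ≢ γ → q ≢ γ → AvoidingWalk γ p q
      edge e p≢γ q≢γ = step e here , p≢γ ∷ q≢γ ∷ []
      toCentre : AvoidingWalk γ s d
      toCentre with s ≟ d
      ... | yes refl = here , s≢γ ∷ []
      ... | no s≢d   = edge (symE (centred st s s∈S s≢d)) s≢γ d≢γ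
      fromCentre : AvoidingWalk γ d t
      fromCentre with t ≟ d
      ... | yes refl = here , t≢γ ∷ []
      ... | no t≢d   = edge (centred st t t∈S t≢d) d≢γ t≢γ

  Linked : Fin m → Subset m → Subset m → Set
  Linked γ S R = ∀ {s r} → s ∈ S → r ∈ R → AvoidingWalk γ s r

  starLinked : IsStar E S → γ ∉ S → Linked γ S S
  starLinked st γ∉S s∈S t∈S =
    throughCentre st (∉⇒≢ γ∉S (centre-∈ st)) s∈S t∈S (∉⇒≢ γ∉S s∈S) (∉⇒≢ γ∉S t∈S)

  linkAt : ∀ {S₁ S₂ R} → Linked γ S R → t ∈ R → t ∈ S₁ → Linked γ S₁ S₂ → Linked γ S S₂
  linkAt link₁ t∈R t∈S₁ link₂ s∈S r∈S₂ = link₁ s∈S t∈R ⨾ link₂ t∈S₁ r∈S₂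

  meetingStarsLinked : IsStar E S → γ ∉ S → IsStar E R → γ ∉ R → Meet S R → Linked γ S R
  meetingStarsLinked stS γ∉S stR γ∉R (t , t∈S , t∈R) =
    linkAt (starLinked stS γ∉S) t∈S t∈R (starLinked stR γ∉R)

  linkedNeighboursEqual : Linked γ S R → s ∈ S → t ∈ R → T (E γ s) → T (E γ t) → s ≡ t
  linkedNeighboursEqual link s∈S t∈R = neighboursEqual (link s∈S t∈R)

  record Port (γ : Fin m) (S R : Subset m) : Set where
    field
      ℓ   : Fin m
      ℓ∈S : ℓ ∈ S
      ℓ∈R : ℓ ∈ R
      γℓ  : T (E γ ℓ)

  port : CentredAt γ R → γ ∉ S → Meet S R → Port γ S R
  port centredR γ∉S (t , t∈S , t∈R) =
    record { ℓ = t ; ℓ∈S = t∈S ; ℓ∈R = t∈R ; γℓ = centredR t t∈R (∉⇒≢ γ∉S t∈S) }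

  -- A star S through γ that meets a star R avoiding γ contains the neighbour
  -- ℓ of γ in R: S ∩ R lies in the component of T − γ containing R, which is
  -- attached to γ only at ℓ.
  portInStar : ∀ {ℓ} → IsStar E S → γ ∈ S → IsStar E R → γ ∉ R → ℓ ∈ R → T (E γ ℓ) → Meet S R → ℓ ∈ S
  portInStar {S} {γ} {ℓ = ℓ} stS γ∈S stR γ∉R ℓ∈R γℓ (s , s∈S , s∈R) with centre stS ≟ γ
  ... | yes refl = subst (_∈ S) (sym ℓ≡s) s∈S
    where
      ℓ≡s : ℓ ≡ s
      ℓ≡s = neighboursEqual (starLinked stR γ∉R ℓ∈R s∈R) γℓ
              (centred stS s s∈S (∉⇒≢ γ∉R s∈R))
  ... | no d≢γ = subst (_∈ S) (sym ℓ≡d) (centre-∈ stS)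
    where
      ℓ≡d : ℓ ≡ centre stS
      ℓ≡d = neighboursEqual
              (starLinked stR γ∉R ℓ∈R s∈R ⨾
               throughCentre stS d≢γ s∈S (centre-∈ stS) (∉⇒≢ γ∉R s∈R) d≢γ)
              γℓ (symE (centred stS γ γ∈S (≢-sym d≢γ)))

  -- A star containing two distinct neighbours of γ is centred at γ: if its
  -- centre were another vertex, the two neighbours would be joined avoiding γ.
  twoNeighboursForceCentre : IsStar E S → s ∈ S → t ∈ S → s ≢ t →
                             T (E γ s) → T (E γ t) → CentredAt γ S
  twoNeighboursForceCentre {γ = γ} st s∈S t∈S s≢t γs γt with centre st ≟ γ
  ... | yes refl = centred st
  ... | no d≢γ = ⊥-elim (s≢t (neighboursEqual
        (throughCentre st d≢γ s∈S t∈S (neighbour≢ γs) (neighbour≢ γt)) γs γt))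

  -- The middle rule, first when γ avoids both P and Q: the ports of P and Q
  -- coincide, and this common port also lies in R (by portInStar if γ ∈ R,
  -- otherwise because it equals the port of R), so P meets R.
  middleRuleAvoiding : CentredAt γ Z → IsStar E P → IsStar E Q → IsStar E R →
                       Meet P Z → Meet Q Z → Meet R Z → Meet P Q → Meet Q R → ¬ Meet P R →
                       γ ∉ P → γ ∉ Q → ⊥
  middleRuleAvoiding {γ} {P = P} {R = R} centredZ stP stQ stR PZ QZ RZ PQ (t , t∈Q , t∈R) P≁R γ∉P γ∉Q =
    P≁R (portQ.ℓ , portQ∈P , portQ∈R)
    where
      module portP = Port (port centredZ γ∉P PZ)
      module portQ = Port (port centredZ γ∉Q QZ)
      portQ∈P : portQ.ℓ ∈ P
      portQ∈P = subst (_∈ P)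
        (linkedNeighboursEqual (meetingStarsLinked stP γ∉P stQ γ∉Q PQ) portP.ℓ∈S portQ.ℓ∈S portP.γℓ portQ.γℓ)
        portP.ℓ∈S
      portQ∈R : portQ.ℓ ∈ R
      portQ∈R with γ ∈? R
      ... | yes γ∈R = portInStar stR γ∈R stQ γ∉Q portQ.ℓ∈S portQ.γℓ (t , t∈R , t∈Q)
      ... | no γ∉R = subst (_∈ R) (sym portQ≡portR) portR.ℓ∈S
        where
          module portR = Port (port centredZ γ∉R RZ)
          portQ≡portR : portQ.ℓ ≡ portR.ℓ
          portQ≡portR = linkedNeighboursEqual (meetingStarsLinked stQ γ∉Q stR γ∉R (t , t∈Q , t∈R))
                          portQ.ℓ∈S portR.ℓ∈S portQ.γℓ portR.γℓ

  middleRule : CentredAt γ Z → IsStar E P → IsStar E Q → IsStar E R →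
               Meet P Z → Meet Q Z → Meet R Z → Meet P Q → Meet Q R → ¬ Meet P R → γ ∈ Q
  middleRule {γ} {P = P} {Q} {R} centredZ stP stQ stR PZ QZ RZ PQ QR P≁R with γ ∈? Q | γ ∈? P | γ ∈? R
  ... | yes γ∈Q | _       | _       = γ∈Q
  ... | no γ∉Q  | no γ∉P  | _       =
    ⊥-elim (middleRuleAvoiding centredZ stP stQ stR PZ QZ RZ PQ QR P≁R γ∉P γ∉Q)
  ... | no γ∉Q  | yes γ∈P | yes γ∈R = ⊥-elim (P≁R (γ , γ∈P , γ∈R))
  ... | no γ∉Q  | yes _   | no γ∉R  =
    ⊥-elim (middleRuleAvoiding centredZ stR stQ stP RZ QZ PZ (swap QR) (swap PQ) (P≁R ∘ swap) γ∉R γ∉Q)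
    where
      swap : ∀ {S R} → Meet S R → Meet R S
      swap (t , t∈S , t∈R) = t , t∈R , t∈S

Faithful : {V : Set} → (V → V → Set) → {m : ℕ} → (V → Subset m) → Set
Faithful {V} Adj {m} f =
  ∀ x y → x ≢ y → (Adj x y → Σ (Fin m) λ t → t ∈ f x × t ∈ f y) ×
                  ((Σ (Fin m) λ t → t ∈ f x × t ∈ f y) → Adj x y)

module SubstarModel {V : Set} {Adj : V → V → Set} {m : ℕ} {E : Fin m → Fin m → Bool}
  (tree : IsTree E) (f : V → Subset m) (star : ∀ v → IsStar E (f v)) (faithful : Faithful Adj f) where
  open TreeFacts tree public

  meets : ∀ x y → x ≢ y → Adj x y → Meet (f x) (f y)
  meets x y x≢y = proj₁ (faithful x y x≢y)

  apart : ∀ x y → x ≢ y → ¬ Adj x y → ¬ Meet (f x) (f y)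
  apart x y x≢y x≁y = x≁y ∘ proj₂ (faithful x y x≢y)

  avoidsBeside : ∀ {γ} x y → x ≢ y → ¬ Adj x y → γ ∈ f y → γ ∉ f x
  avoidsBeside {γ} x y x≢y x≁y γ∈y γ∈x = apart x y x≢y x≁y (γ , γ∈x , γ∈y)

  linkedAdjacent : ∀ {γ} x y → x ≢ y → Adj x y → γ ∉ f x → γ ∉ f y → Linked γ (f x) (f y)
  linkedAdjacent x y x≢y x∼y γ∉x γ∉y = meetingStarsLinked (star x) γ∉x (star y) γ∉y (meets x y x≢y x∼y)

  chainVia : ∀ {γ x w} y → Linked γ (f x) (f y) → Linked γ (f y) (f w) → Linked γ (f x) (f w)
  chainVia y link₁ link₂ = linkAt link₁ (centre-∈ (star y)) (centre-∈ (star y)) link₂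

-- H₁: the middle rule applied to a, x, w and to w, y, b puts the centre of
-- f(z) into both f(x) and f(y), although x ≁ y.
H₁-not-substar : ¬ IsSubstar V₁ Adj₁
H₁-not-substar (_ , _ , tree , f , star , faithful) = apart x y (λ ()) (λ ()) (γ , γ∈x , γ∈y)
  where
    open V₁
    open SubstarModel tree f star faithful
    γ = centre (star z)
    γ∈x : γ ∈ f x
    γ∈x = middleRule (centred (star z)) (star a) (star x) (star w)
            (meets a z (λ ()) tt) (meets x z (λ ()) tt) (meets w z (λ ()) tt)
            (meets a x (λ ()) tt) (meets x w (λ ()) tt) (apart a w (λ ()) (λ ()))
    γ∈y : γ ∈ f y
    γ∈y = middleRule (centred (star z)) (star w) (star y) (star b)
            (meets w z (λ ()) tt) (meets y z (λ ()) tt) (meets b z (λ ()) tt)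
            (meets w y (λ ()) tt) (meets y b (λ ()) tt) (apart w b (λ ()) (λ ()))

-- H₂ (each type): the same argument with the induced paths u x a and v y b;
-- the optional edges uv, uy, ub, vx, va never involve ua, vb or xy, so the
-- argument is uniform in the type.
H₂-not-substar : ∀ (ty : H₂Type) → ¬ IsSubstar V₂ (Adj₂ ty)
H₂-not-substar ty (_ , _ , tree , f , star , faithful) = apart x y (λ ()) (λ ()) (γ , γ∈x , γ∈y)
  where
    open V₂
    open SubstarModel tree f star faithful
    γ = centre (star z)
    γ∈x : γ ∈ f x
    γ∈x = middleRule (centred (star z)) (star u) (star x) (star a)
            (meets u z (λ ()) tt) (meets x z (λ ()) tt) (meets a z (λ ()) tt)
            (meets u x (λ ()) tt) (meets x a (λ ()) tt) (apart u a (λ ()) (λ ()))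
    γ∈y : γ ∈ f y
    γ∈y = middleRule (centred (star z)) (star v) (star y) (star b)
            (meets v z (λ ()) tt) (meets y z (λ ()) tt) (meets b z (λ ()) tt)
            (meets v y (λ ()) tt) (meets y b (λ ()) tt) (apart v b (λ ()) (λ ()))

module H₃-argument (n : ℕ) {m : ℕ} {E : Fin m → Fin m → Bool} (tree : IsTree E)
  (f : V₃ (3 + n) → Subset m) (star : ∀ v → IsStar E (f v)) (faithful : Faithful (Adj₃ (3 + n)) f) where
  open V₃
  open SubstarModel tree f star faithful

  K : ℕ
  K = 3 + n

  c₁ c₂ a₁ a₂ : V₃ K
  c₁ = c 1 (s≤s z≤n) (s≤s (s≤s z≤n))
  c₂ = c 2 (s≤s z≤n) (s≤s (s≤s (s≤s z≤n)))
  a₁ = a 1 (s≤s z≤n) (s≤s z≤n)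
  a₂ = a 2 (s≤s z≤n) (s≤s (s≤s z≤n))

  γ : Fin m
  γ = centre (star c₁)

  portToC₁ : ∀ x → x ≢ c₁ → Adj₃ K x c₁ → γ ∉ f x → Port γ (f x) (f c₁)
  portToC₁ x x≢c₁ x∼c₁ γ∉x = port (centred (star c₁)) γ∉x (meets x c₁ x≢c₁ x∼c₁)

  -- Case γ ∈ f(u).  Then γ avoids f(v) and every f(aᵢ) with i ≥ 2, and all
  -- the f(cᵢ) are centred at γ; the port of aₖ then equals the port q of v,
  -- which lies in f(c₁), although aₖ ≁ c₁.
  module WhenγInU (γ∈u : γ ∈ f u) where
    γ∉v : γ ∉ f v
    γ∉v = avoidsBeside v u (λ ()) (λ ()) γ∈u

    module q = Port (portToC₁ v (λ ()) tt γ∉v)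

    -- If f(cᵢ) is centred at γ, so is f(cᵢ₊₁): the port t of aᵢ₊₁ into f(cᵢ)
    -- differs from q (as aᵢ₊₁ ≁ v), so γ ∈ f(cᵢ₊₁) (else t and q would be
    -- linked through f(cᵢ₊₁)); then f(cᵢ₊₁) contains both ports t and q.
    propagate : ∀ {j h₁ h₂ h₁′ h₂′} → CentredAt γ (f (c (suc j) h₁ h₂)) →
                CentredAt γ (f (c (suc (suc j)) h₁′ h₂′))
    propagate {j} {h₁} {h₂} {h₁′} {h₂′} cᵢ-centred = byMembership (γ ∈? f cᵢ₊₁)
      where
        cᵢ cᵢ₊₁ aᵢ₊₁ : V₃ K
        cᵢ = c (suc j) h₁ h₂
        cᵢ₊₁ = c (suc (suc j)) h₁′ h₂′
        aᵢ₊₁ = a (suc (suc j)) (s≤s z≤n) (<⇒≤ h₂′)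
        γ∉aᵢ₊₁ : γ ∉ f aᵢ₊₁
        γ∉aᵢ₊₁ = avoidsBeside aᵢ₊₁ u (λ ()) (λ ()) γ∈u
        module t = Port (port cᵢ-centred γ∉aᵢ₊₁ (meets aᵢ₊₁ cᵢ (λ ()) (inj₂ refl)))
        t≢q : t.ℓ ≢ q.ℓ
        t≢q t≡q = apart aᵢ₊₁ v (λ ()) (<⇒≢ h₂′) (t.ℓ , t.ℓ∈S , subst (_∈ f v) (sym t≡q) q.ℓ∈S)
        byMembership : Dec (γ ∈ f cᵢ₊₁) → CentredAt γ (f cᵢ₊₁)
        byMembership (no γ∉cᵢ₊₁) = ⊥-elim (t≢q (linkedNeighboursEqual
          (chainVia cᵢ₊₁ (linkedAdjacent aᵢ₊₁ cᵢ₊₁ (λ ()) (inj₁ refl) γ∉aᵢ₊₁ γ∉cᵢ₊₁)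
                         (linkedAdjacent cᵢ₊₁ v (λ ()) tt γ∉cᵢ₊₁ γ∉v))
          t.ℓ∈S q.ℓ∈S t.γℓ q.γℓ))
        byMembership (yes γ∈cᵢ₊₁) = twoNeighboursForceCentre (star cᵢ₊₁) q∈cᵢ₊₁ t∈cᵢ₊₁ (≢-sym t≢q) q.γℓ t.γℓ
          where
            q∈cᵢ₊₁ : q.ℓ ∈ f cᵢ₊₁
            q∈cᵢ₊₁ = portInStar (star cᵢ₊₁) γ∈cᵢ₊₁ (star v) γ∉v q.ℓ∈S q.γℓ (meets cᵢ₊₁ v (λ ()) tt)
            t∈cᵢ₊₁ : t.ℓ ∈ f cᵢ₊₁
            t∈cᵢ₊₁ = portInStar (star cᵢ₊₁) γ∈cᵢ₊₁ (star aᵢ₊₁) γ∉aᵢ₊₁ t.ℓ∈S t.γℓ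
                       (meets cᵢ₊₁ aᵢ₊₁ (λ ()) (inj₁ refl))

    allCentred : ∀ i h₁ h₂ → CentredAt γ (f (c i h₁ h₂))
    allCentred 1 (s≤s z≤n) (s≤s (s≤s z≤n)) = centred (star c₁)
    allCentred (suc (suc j)) h₁ h₂ = propagate (allCentred (suc j) (s≤s z≤n) (≤-trans (n≤1+n _) h₂))

    contradiction : ⊥
    contradiction = apart aₖ c₁ (λ ()) (λ { (inj₁ ()) ; (inj₂ ()) }) (q.ℓ , subst (_∈ f aₖ) t≡q t.ℓ∈S , q.ℓ∈R)
      where
        aₖ cₖ₋₁ : V₃ K
        aₖ = a K (s≤s z≤n) ≤-refl
        cₖ₋₁ = c (2 + n) (s≤s z≤n) ≤-refl
        γ∉aₖ : γ ∉ f aₖ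
        γ∉aₖ = avoidsBeside aₖ u (λ ()) (λ ()) γ∈u
        module t = Port (port (allCentred _ _ _) γ∉aₖ (meets aₖ cₖ₋₁ (λ ()) (inj₂ refl)))
        t≡q : t.ℓ ≡ q.ℓ
        t≡q = linkedNeighboursEqual (linkedAdjacent aₖ v (λ ()) refl γ∉aₖ γ∉v) t.ℓ∈S q.ℓ∈S t.γℓ q.γℓ

  module WhenγNotInU (γ∉u : γ ∉ f u) where
    module p = Port (portToC₁ u (λ ()) tt γ∉u)

    -- If γ ∈ f(c₂), then p ∈ f(c₂), and the port of a₁ (linked to u) is p,
    -- so f(a₁) meets f(c₂) although a₁ ≁ c₂.
    whenγInC₂ : γ ∈ f c₂ → ⊥
    whenγInC₂ γ∈c₂ = apart a₁ c₂ (λ ()) (λ { (inj₁ ()) ; (inj₂ ()) }) (p.ℓ , subst (_∈ f a₁) t≡p t.ℓ∈S , p∈c₂)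
      where
        γ∉a₁ : γ ∉ f a₁
        γ∉a₁ = avoidsBeside a₁ c₂ (λ ()) (λ { (inj₁ ()) ; (inj₂ ()) }) γ∈c₂
        module t = Port (portToC₁ a₁ (λ ()) (inj₁ refl) γ∉a₁)
        p∈c₂ : p.ℓ ∈ f c₂
        p∈c₂ = portInStar (star c₂) γ∈c₂ (star u) γ∉u p.ℓ∈S p.γℓ (meets c₂ u (λ ()) tt)
        t≡p : t.ℓ ≡ p.ℓ
        t≡p = linkedNeighboursEqual (linkedAdjacent a₁ u (λ ()) refl γ∉a₁ γ∉u) t.ℓ∈S p.ℓ∈S t.γℓ p.γℓ

    -- If γ ∉ f(c₂), then f(u) is linked through f(c₂) to f(a₂) when γ ∈ f(v)
    -- and to f(v) otherwise; the ports coincide, so a₂ or v would meet u.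
    whenγNotInC₂ : γ ∉ f c₂ → ⊥
    whenγNotInC₂ γ∉c₂ with γ ∈? f v
    ... | yes γ∈v = apart a₂ u (λ ()) (λ ()) (p.ℓ , subst (_∈ f a₂) t≡p t.ℓ∈S , p.ℓ∈S)
      where
        γ∉a₂ : γ ∉ f a₂
        γ∉a₂ = avoidsBeside a₂ v (λ ()) (λ ()) γ∈v
        module t = Port (portToC₁ a₂ (λ ()) (inj₂ refl) γ∉a₂)
        t≡p : t.ℓ ≡ p.ℓ
        t≡p = linkedNeighboursEqual
                (chainVia c₂ (linkedAdjacent a₂ c₂ (λ ()) (inj₁ refl) γ∉a₂ γ∉c₂)
                             (linkedAdjacent c₂ u (λ ()) tt γ∉c₂ γ∉u))
                t.ℓ∈S p.ℓ∈S t.γℓ p.γℓ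
    ... | no γ∉v = apart u v (λ ()) (λ ()) (p.ℓ , p.ℓ∈S , subst (_∈ f v) (sym p≡q) q.ℓ∈S)
      where
        module q = Port (portToC₁ v (λ ()) tt γ∉v)
        p≡q : p.ℓ ≡ q.ℓ
        p≡q = linkedNeighboursEqual
                (chainVia c₂ (linkedAdjacent u c₂ (λ ()) tt γ∉u γ∉c₂)
                             (linkedAdjacent c₂ v (λ ()) tt γ∉c₂ γ∉v))
                p.ℓ∈S q.ℓ∈S p.γℓ q.γℓ

  contradiction : ⊥
  contradiction with γ ∈? f u | γ ∈? f c₂
  ... | yes γ∈u | _        = WhenγInU.contradiction γ∈u
  ... | no γ∉u  | yes γ∈c₂ = WhenγNotInU.whenγInC₂ γ∉u γ∈c₂
  ... | no γ∉u  | no γ∉c₂  = WhenγNotInU.whenγNotInC₂ γ∉u γ∉c₂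

H₃-not-substar : ∀ (k : ℕ) → 3 ≤ k → ¬ IsSubstar (V₃ k) (Adj₃ k)
H₃-not-substar (suc (suc (suc n))) (s≤s (s≤s (s≤s z≤n))) (_ , _ , tree , f , star , faithful) =
  H₃-argument.contradiction n tree f star faithful

lemma1 : ¬ IsSubstar V₁ Adj₁
         × (∀ (t : H₂Type) → ¬ IsSubstar V₂ (Adj₂ t))
         × (∀ (k : ℕ) → 3 ≤ k → ¬ IsSubstar (V₃ k) (Adj₃ k))
lemma1 = H₁-not-substar , H₂-not-substar , H₃-not-substar
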